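{- For every integer $k\geq 1$, the hypercube $Q_{2^k}$ has a Hamiltonian cycle whose edge set is a fundamental set for $Q_{2^k}$.
   Context: $Q_n$ is the $n$-dimensional hypercube: its vertex set is the set of subsets of $\{1,2,\ldots,n\}$, and two vertices $x,y$ are adjacent iff $|x\,\Delta\, y|=1$. A fundamental set of edges of a graph $G$ is a subset of $E(G)$ whose translates under some subgroup of the automorphism group $\mathrm{Aut}(G)$ partition $E(G)$. -}

module Defs where

open import Data.Nat using (ℕ; suc; _^_)
open import Data.Fin using (Fin)
open import Data.Fin.Subset using (Subset; _∪_; _─_; ∣_∣)
open import Data.Product using (Σ; ∃; ∃-syntax; _×_; _,_)
open import Data.Sum using (_⊎_)
open import Function using (_∘_; id)
open import Relation.Binary.PropositionalEquality using (_≡_; refl; sym)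
open import Relation.Nullary using (¬_)

Vertex : ℕ → Set
Vertex n = Subset n

_Δ_ : ∀ {n} → Subset n → Subset n → Subset n
x Δ y = (x ─ y) ∪ (y ─ x)

Adj : ∀ {n} → Vertex n → Vertex n → Set
Adj x y = ∣ x Δ y ∣ ≡ 1

-- A set of edges of Q_n, given as a relation on vertices (an edge {x,y}
-- is in the set iff the relation holds for (x,y); edge sets are symmetric).
EdgeSet : ℕ → Set₁
EdgeSet n = Vertex n → Vertex n → Set

record Aut (n : ℕ) : Set where
  field
    fun      : Vertex n → Vertex n
    inv      : Vertex n → Vertex n
    inv-fun  : ∀ x → inv (fun x) ≡ x
    fun-inv  : ∀ x → fun (inv x) ≡ x
    preserve : ∀ x y → Adj x y → Adj (fun x) (fun y)
    reflect  : ∀ x y → Adj (fun x) (fun y) → Adj x y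
open Aut public

idAut : ∀ {n} → Aut n
idAut = record { fun = id ; inv = id ; inv-fun = λ _ → refl
               ; fun-inv = λ _ → refl
               ; preserve = λ _ _ a → a ; reflect = λ _ _ a → a }

open import Relation.Binary.PropositionalEquality using (trans; cong; subst)

_∘A_ : ∀ {n} → Aut n → Aut n → Aut n
a ∘A b = record
  { fun = fun a ∘ fun b
  ; inv = inv b ∘ inv a
  ; inv-fun = λ x → trans (cong (inv b) (inv-fun a (fun b x))) (inv-fun b x)
  ; fun-inv = λ x → trans (cong (fun a) (fun-inv b (inv a x))) (fun-inv a x)
  ; preserve = λ x y p → preserve a _ _ (preserve b x y p)
  ; reflect = λ x y p → reflect b x y (reflect a _ _ p)
  }

invAut : ∀ {n} → Aut n → Aut n
invAut a = record
  { fun = inv a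
  ; inv = fun a
  ; inv-fun = fun-inv a
  ; fun-inv = inv-fun a
  ; preserve = λ x y p → reflect a _ _
      (subst (λ u → Adj u (fun a (inv a y))) (sym (fun-inv a x))
        (subst (λ v → Adj x v) (sym (fun-inv a y)) p))
  ; reflect = λ x y p →
      subst (λ u → Adj u y) (fun-inv a x)
        (subst (λ v → Adj (fun a (inv a x)) v) (fun-inv a y) (preserve a _ _ p))
  }

record IsSubgroup {n : ℕ} (H : Aut n → Set) : Set where
  field
    has-id  : H idAut
    has-∘   : ∀ {a b} → H a → H b → H (a ∘A b)
    has-inv : ∀ {a} → H a → H (invAut a)

Translate : ∀ {n} → Aut n → EdgeSet n → EdgeSet n
Translate g F x y = ∃[ u ] ∃[ v ] (F u v × x ≡ fun g u × y ≡ fun g v)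

IsEdgeSubset : ∀ {n} → EdgeSet n → Set
IsEdgeSubset F = ∀ x y → F x y → Adj x y

TranslatesPartition : ∀ {n} → (Aut n → Set) → EdgeSet n → Set
TranslatesPartition {n} H F =
  (∀ x y → Adj x y → ∃[ g ] (H g × Translate g F x y))
  × (∀ g h → H g → H h → ∀ x y → Translate g F x y → Translate h F x y →
       ∀ u v → (Translate g F u v → Translate h F u v)
             × (Translate h F u v → Translate g F u v))

IsFundamental : ∀ {n} → EdgeSet n → Set₁
IsFundamental {n} F =
  IsEdgeSubset F × ∃[ H ] (IsSubgroup H × TranslatesPartition H F)

-- Hamiltonian cycles of Q_n: a cyclic listing c 0, c 1, …, c (2^n − 1)
-- of all vertices, each exactly once, consecutive ones (cyclically) adjacent.
open import Data.Fin using (zero; suc; fromℕ; toℕ; inject₁)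
open import Data.Nat using (_∸_)
open import Data.Nat.DivMod using (_mod_)
open import Function.Definitions using (Injective; Surjective)

nextMod : ∀ {m} → Fin (suc m) → Fin (suc m)
nextMod {m} i = (suc (toℕ i)) mod (suc m)

-- 2^n written as suc of something
pred2^ : ℕ → ℕ
pred2^ n = (2 ^ n) ∸ 1

record HamCycle (n : ℕ) : Set where
  field
    vert     : Fin (suc (pred2^ n)) → Vertex n
    injective  : Injective _≡_ _≡_ vert
    surjective : Surjective _≡_ _≡_ vert
    adjacent : ∀ i → Adj (vert i) (vert (nextMod i))
open HamCycle public

CycleEdges : ∀ {n} → HamCycle n → EdgeSet n
CycleEdges C x y = ∃[ i ] ((x ≡ vert C i × y ≡ vert C (nextMod i))
                          ⊎ (y ≡ vert C i × x ≡ vert C (nextMod i)))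

-- Call a Hamiltonian cycle C of a graph G fundamental for a group acting on G
-- if the translates of E(C) cover E(G) and every symmetry moving some edge of
-- C onto an edge of C is trivial, so that two translates are equal or disjoint
-- (record FundamentalCycle).  The key construction (module Square) turns a
-- fundamental cycle of length N ≥ 3 of G into one of length N² of the
-- Cartesian square G □ G, for the group Sym × Z/2 with Z/2 swapping the two
-- coordinates: the new cycle, the tour, moves along the first coordinate and
-- climbs in the second exactly on one anti-diagonal, so every cycle edge of G
-- occurs in the tour either in the first coordinate or, after a swap, in the
-- second, while no swap carries a tour edge onto a tour edge.  Since
-- Q_(2n) ≅ Q_n □ Q_n and Q_2 is a 4-cycle, iterating gives fundamental cycles
-- of every Q_(2^k) (hypercube-fundamental); module Conclusion restates this
-- with the notions HamCycle and IsFundamental of the statement.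

module Submission where

open import Data.Bool using (Bool; true; false; not; _xor_)
open import Data.Empty using (⊥; ⊥-elim)
open import Data.Fin using (Fin; toℕ)
open import Data.Fin.Properties using (toℕ-injective; toℕ<n; toℕ-fromℕ<)
open import Data.Fin.Subset using (_─_; ∣_∣)
open import Data.Fin.Subset.Properties using (∪-comm)
open import Data.Nat using (ℕ; zero; suc; _+_; _*_; _^_; _≤_; _<_; z≤n; s≤s; s≤s⁻¹; z<s; _%_; _/_; _<?_; _≟_)
open import Data.Nat.DivMod
open import Data.Nat.Properties
open import Data.Nat.Tactic.RingSolver using (solve-∀)
open import Data.Product using (∃-syntax; _×_; _,_; proj₁; proj₂; swap)
open import Data.Product.Properties using (,-injectiveˡ; ,-injectiveʳ)
open import Data.Unit using (⊤; tt)
open import Data.Sum using (_⊎_; inj₁; inj₂)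
open import Data.Vec using (_∷_; []; _++_; take; drop)
open import Data.Vec.Properties using (take++drop≡id; ++-injectiveˡ; ++-injectiveʳ)
open import Function using (id)
open import Relation.Binary.PropositionalEquality
open import Relation.Nullary using (¬_; yes; no)
open import Defs

record Graph : Set₁ where
  field
    V        : Set
    _~_      : V → V → Set
    ~-sym    : ∀ {x y} → x ~ y → y ~ x
    ~-irrefl : ∀ {x} → ¬ (x ~ x)

CycleEdge : {V : Set} → (ℕ → V) → V → V → Set
CycleEdge c u v = ∃[ i ] ((u ≡ c i × v ≡ c (suc i)) ⊎ (u ≡ c (suc i) × v ≡ c i))

CycleEdge-sym : ∀ {V : Set} {c : ℕ → V} {u v} → CycleEdge c u v → CycleEdge c v u
CycleEdge-sym (i , inj₁ (u≡ , v≡)) = i , inj₂ (v≡ , u≡)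
CycleEdge-sym (i , inj₂ (u≡ , v≡)) = i , inj₁ (v≡ , u≡)

module Mod (M : ℕ) where
  N : ℕ
  N = suc M

  infix 4 _≈_
  _≈_ : ℕ → ℕ → Set
  a ≈ b = a % N ≡ b % N

  ≈-+ : ∀ {a a' b b'} → a ≈ a' → b ≈ b' → a + b ≈ a' + b'
  ≈-+ {a} {a'} {b} {b'} a≈ b≈ = begin
    (a + b) % N              ≡⟨ %-distribˡ-+ a b N ⟩
    (a % N + b % N) % N      ≡⟨ cong₂ (λ x y → (x + y) % N) a≈ b≈ ⟩
    (a' % N + b' % N) % N    ≡⟨ %-distribˡ-+ a' b' N ⟨
    (a' + b') % N            ∎
    where open ≡-Reasoning

  ≈-suc : ∀ {a b} → a ≈ b → suc a ≈ suc b
  ≈-suc {a} {b} = ≈-+ {1} {1} {a} {b} refl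

  +-multiple : ∀ a k → a + k * N ≈ a
  +-multiple a k = [m+kn]%n≡m%n a k N

  mod-≈ : ∀ a → a % N ≈ a
  mod-≈ a = m%n%n≡m%n a N

  ≈-cancelʳ : ∀ {a b} k → a + k ≈ b + k → a ≈ b
  ≈-cancelʳ {a} {b} k a+k≈b+k = begin
    a % N                     ≡⟨ +-multiple a k ⟨
    (a + k * N) % N           ≡⟨ cong (_% N) (shift a) ⟩
    (a + k + k * M) % N       ≡⟨ ≈-+ {a + k} {b + k} {k * M} a+k≈b+k refl ⟩
    (b + k + k * M) % N       ≡⟨ cong (_% N) (shift b) ⟨
    (b + k * N) % N           ≡⟨ +-multiple b k ⟩
    b % N                     ∎
    where
    open ≡-Reasoning
    shift : ∀ x → x + k * N ≡ x + k + k * M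
    shift x = trans (cong (x +_) (*-suc k M)) (sym (+-assoc x k (k * M)))

  divmod-unique : ∀ j q r → r < N → j ≡ r + q * N → (j % N ≡ r) × (j / N ≡ q)
  divmod-unique j q r r<N refl = rem , quot
    where
    rem : (r + q * N) % N ≡ r
    rem = trans (+-multiple r q) (m<n⇒m%n≡m r<N)
    quot : (r + q * N) / N ≡ q
    quot = *-cancelʳ-≡ _ q N (+-cancelˡ-≡ r _ _
             (trans (cong (_+ (r + q * N) / N * N) (sym rem)) (sym (m≡m%n+[m/n]*n (r + q * N) N))))

-- Together these say the translates partition E(G).
record FundamentalCycle (G : Graph) (M : ℕ) : Set₁ where
  open Graph G
  field
    length≥3       : 2 ≤ M
    cyc            : ℕ → V
    cyc-periodic   : ∀ i → cyc (i + suc M) ≡ cyc i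
    cyc-injective  : ∀ i j → i < suc M → j < suc M → cyc i ≡ cyc j → i ≡ j
    cyc-surjective : ∀ x → ∃[ i ] (cyc i ≡ x)
    cyc-adjacent   : ∀ i → cyc i ~ cyc (suc i)
    Sym          : Set
    one          : Sym
    _·_          : Sym → Sym → Sym
    _⁻¹          : Sym → Sym
    act          : Sym → V → V
    act-one      : ∀ x → act one x ≡ x
    act-·        : ∀ p q x → act (p · q) x ≡ act p (act q x)
    act-inverseˡ : ∀ p x → act (p ⁻¹) (act p x) ≡ x
    act-inverseʳ : ∀ p x → act p (act (p ⁻¹) x) ≡ x
    act-adjacent : ∀ p {x y} → x ~ y → act p x ~ act p y
    covering     : ∀ x y → x ~ y →
                   ∃[ p ] ∃[ u ] ∃[ v ] (CycleEdge cyc u v × x ≡ act p u × y ≡ act p v)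
    rigidity     : ∀ p u v → CycleEdge cyc u v → CycleEdge cyc (act p u) (act p v) →
                   ∀ z → act p z ≡ z

module CycleFacts {G : Graph} {M : ℕ} (F : FundamentalCycle G M) where
  open Graph G
  open FundamentalCycle F
  open Mod M

  cyc-+multiple : ∀ a k → cyc (a + k * N) ≡ cyc a
  cyc-+multiple a zero    = cong cyc (+-identityʳ a)
  cyc-+multiple a (suc k) = begin
    cyc (a + (N + k * N))   ≡⟨ cong cyc (trans (cong (a +_) (+-comm N (k * N))) (sym (+-assoc a (k * N) N))) ⟩
    cyc (a + k * N + N)     ≡⟨ cyc-periodic (a + k * N) ⟩
    cyc (a + k * N)         ≡⟨ cyc-+multiple a k ⟩
    cyc a                   ∎
    where open ≡-Reasoning

  cyc-mod : ∀ a → cyc (a % N) ≡ cyc a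
  cyc-mod a = trans (sym (cyc-+multiple (a % N) (a / N))) (cong cyc (sym (m≡m%n+[m/n]*n a N)))

  cyc-≈ : ∀ {a b} → a ≈ b → cyc a ≡ cyc b
  cyc-≈ {a} {b} a≈b = trans (sym (cyc-mod a)) (trans (cong cyc a≈b) (cyc-mod b))

  cyc-≈⁻¹ : ∀ {a b} → cyc a ≡ cyc b → a ≈ b
  cyc-≈⁻¹ {a} {b} eq = cyc-injective (a % N) (b % N) (m%n<n a N) (m%n<n b N)
                         (trans (cyc-mod a) (trans eq (sym (cyc-mod b))))

  cyc-suc-cong : ∀ {a b} → cyc a ≡ cyc b → cyc (suc a) ≡ cyc (suc b)
  cyc-suc-cong eq = cyc-≈ (≈-suc (cyc-≈⁻¹ eq))

  cyc-suc-distinct : ∀ a → ¬ (cyc a ≡ cyc (suc a))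
  cyc-suc-distinct a eq = ~-irrefl (subst (_~ cyc (suc a)) eq (cyc-adjacent a))

  -- Since N ≥ 3, no cycle edge is traversed in both directions by a shift.
  no-reversal : ∀ a b → cyc a ≡ cyc (suc b) → cyc (suc a) ≡ cyc b → ⊥
  no-reversal a b a≡ a+1≡ = 2≉0 (≈-cancelʳ {2} {0} b (trans (sym (≈-suc {a} {suc b} (cyc-≈⁻¹ a≡))) (cyc-≈⁻¹ a+1≡)))
    where
    2≉0 : ¬ (2 ≈ 0)
    2≉0 eq with trans (sym (m<n⇒m%n≡m (s≤s length≥3))) eq
    ... | ()

_□_ : Graph → Graph → Graph
G □ H = record { V = G.V × H.V ; _~_ = Adj□ ; ~-sym = sym□ ; ~-irrefl = irrefl□ }
  where
  module G = Graph G
  module H = Graph H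
  Adj□ : G.V × H.V → G.V × H.V → Set
  Adj□ (x , y) (x' , y') = (x G.~ x' × y ≡ y') ⊎ (x ≡ x' × y H.~ y')
  sym□ : ∀ {X Y} → Adj□ X Y → Adj□ Y X
  sym□ (inj₁ (x~x' , y≡y')) = inj₁ (G.~-sym x~x' , sym y≡y')
  sym□ (inj₂ (x≡x' , y~y')) = inj₂ (sym x≡x' , H.~-sym y~y')
  irrefl□ : ∀ {X} → ¬ Adj□ X X
  irrefl□ (inj₁ (x~x , _)) = G.~-irrefl x~x
  irrefl□ (inj₂ (_ , y~y)) = H.~-irrefl y~y

swapIf : {A : Set} → Bool → A × A → A × A
swapIf false = id
swapIf true  = swap

swapIf-xor : {A : Set} → ∀ s t (X : A × A) → swapIf (s xor t) X ≡ swapIf s (swapIf t X)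
swapIf-xor false t     X = refl
swapIf-xor true  false X = refl
swapIf-xor true  true  X = refl

swapIf-involutive : {A : Set} → ∀ s (X : A × A) → swapIf s (swapIf s X) ≡ X
swapIf-involutive false X = refl
swapIf-involutive true  X = refl

row-identity : ∀ r q m → suc (r + m * q + q) ≡ suc r + q * suc m
row-identity = solve-∀

row-end-identity : ∀ q m → suc (m + m * q + q) ≡ 0 + suc q * suc m
row-end-identity = solve-∀

diagonal-identity : ∀ i q m → i + q + m * q ≡ i + q * suc m
diagonal-identity = solve-∀

module Square {G : Graph} {M : ℕ} (F : FundamentalCycle G M) where
  open Graph G
  open FundamentalCycle F
  open Mod M
  open CycleFacts F
  open Graph (G □ G) using () renaming (_~_ to _~□_)

  -- As
  -- M ≡ -1, the index sum there is r: row q of the tour runs along the first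
  -- coordinate through the anti-diagonals 0, 1, …, M, then climbs to row q + 1.
  tour : ℕ → V × V
  tour j = cyc (j % N + M * (j / N)) , cyc (j / N)

  tour-at : ∀ j {r q} → j % N ≡ r → j / N ≡ q → tour j ≡ (cyc (r + M * q) , cyc q)
  tour-at j refl refl = refl

  data Step : V × V → V × V → Set where
    horizontal : ∀ u v → ¬ (suc (u + v) ≈ 0) → Step (cyc u , cyc v) (cyc (suc u) , cyc v)
    vertical   : ∀ u v → suc (u + v) ≈ 0 → Step (cyc u , cyc v) (cyc u , cyc (suc v))

  -- The tour obeys this rule: inside a row it moves horizontally, and at the
  -- end of a row (remainder M, the anti-diagonal) it climbs.
  tour-step : ∀ j → Step (tour j) (tour (suc j))
  tour-step j with suc (j % N) <? N
  ... | yes r+1<N = subst (Step (tour j)) (sym (tour-at (suc j) (proj₁ next) (proj₂ next)))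
                          (horizontal (j % N + M * q) q off-diagonal)
    where
    q = j / N
    next = divmod-unique (suc j) q (suc (j % N)) r+1<N (cong suc (m≡m%n+[m/n]*n j N))
    off-diagonal : ¬ (suc (j % N + M * q + q) ≈ 0)
    off-diagonal eq with trans (sym (m<n⇒m%n≡m r+1<N))
                         (trans (sym (+-multiple (suc (j % N)) q))
                           (trans (cong (_% N) (sym (row-identity (j % N) q M))) eq))
    ... | ()
  ... | no r+1≮N = subst (Step (tour j)) (sym tour-next) (vertical (j % N + M * q) q on-diagonal)
    where
    open ≡-Reasoning
    q = j / N
    r≡M : j % N ≡ M
    r≡M = ≤-antisym (s≤s⁻¹ (m%n<n j N)) (≮⇒≥ (λ r<M → r+1≮N (s≤s r<M)))
    next = divmod-unique (suc j) (suc q) 0 z<s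
             (cong suc (trans (m≡m%n+[m/n]*n j N) (cong (_+ q * N) r≡M)))
    tour-next : tour (suc j) ≡ (cyc (j % N + M * q) , cyc (suc q))
    tour-next = trans (tour-at (suc j) (proj₁ next) (proj₂ next))
                  (cong (λ k → cyc k , cyc (suc q)) (trans (*-suc M q) (cong (_+ M * q) (sym r≡M))))
    on-diagonal : suc (j % N + M * q + q) ≈ 0
    on-diagonal = begin
      suc (j % N + M * q + q) % N   ≡⟨ cong (λ r → suc (r + M * q + q) % N) r≡M ⟩
      suc (M + M * q + q) % N       ≡⟨ cong (_% N) (row-end-identity q M) ⟩
      (0 + suc q * N) % N           ≡⟨ +-multiple 0 (suc q) ⟩
      0 % N                         ∎

  step-adjacent : ∀ {X Y} → Step X Y → X ~□ Y
  step-adjacent (horizontal u v _) = inj₁ (cyc-adjacent u , refl)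
  step-adjacent (vertical u v _)   = inj₂ (refl , cyc-adjacent v)

  M² : ℕ
  M² = M + M * suc M

  tour-periodic : ∀ i → tour (i + suc M²) ≡ tour i
  tour-periodic i = trans (tour-at (i + suc M²) (proj₁ next-round) (proj₂ next-round))
                      (cong₂ _,_ (trans (cong cyc shift) (cyc-+multiple (i % N + M * (i / N)) M))
                                 (cyc-periodic (i / N)))
    where
    next-round = divmod-unique (i + N * N) (i / N + N) (i % N) (m%n<n i N)
      (trans (cong (_+ N * N) (m≡m%n+[m/n]*n i N))
        (trans (+-assoc (i % N) _ _) (cong (i % N +_) (sym (*-distribʳ-+ N (i / N) N)))))
    shift : i % N + M * (i / N + N) ≡ i % N + M * (i / N) + M * N
    shift = trans (cong (i % N +_) (*-distribˡ-+ M (i / N) N)) (sym (+-assoc (i % N) _ _))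

  tour-injective : ∀ i j → i < suc M² → j < suc M² → tour i ≡ tour j → i ≡ j
  tour-injective i j i< j< eq = begin
    i                        ≡⟨ m≡m%n+[m/n]*n i N ⟩
    i % N + (i / N) * N      ≡⟨ cong₂ (λ a b → a + b * N) same-rem same-row ⟩
    j % N + (j / N) * N      ≡⟨ m≡m%n+[m/n]*n j N ⟨
    j                        ∎
    where
    open ≡-Reasoning
    same-row : i / N ≡ j / N
    same-row = cyc-injective _ _ (m<n*o⇒m/o<n i<) (m<n*o⇒m/o<n j<) (,-injectiveʳ eq)
    same-col : cyc (i % N + M * (i / N)) ≡ cyc (j % N + M * (i / N))
    same-col = trans (,-injectiveˡ eq) (cong (λ q → cyc (j % N + M * q)) (sym same-row))
    same-rem : i % N ≡ j % N
    same-rem = trans (sym (mod-≈ i))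
                 (trans (≈-cancelʳ {i % N} {j % N} (M * (i / N)) (cyc-≈⁻¹ same-col)) (mod-≈ j))

  -- (cyc a, cyc q) lies on row q, at remainder (a + q) mod N.
  tour-surjective : ∀ X → ∃[ j ] (tour j ≡ X)
  tour-surjective (x , y) with cyc-surjective x | cyc-surjective y
  ... | a , refl | q , refl = r + q * N ,
        trans (tour-at (r + q * N) (proj₁ pos) (proj₂ pos)) (cong (_, cyc q) (cyc-≈ r+Mq≈a))
    where
    r = (a + q) % N
    pos = divmod-unique (r + q * N) q r (m%n<n (a + q) N) refl
    r+Mq≈a : r + M * q ≈ a
    r+Mq≈a = trans (≈-+ {r} {a + q} {M * q} (mod-≈ (a + q)) refl)
               (trans (cong (_% N) (diagonal-identity a q M)) (+-multiple a q))

  tour-adjacent : ∀ i → tour i ~□ tour (suc i)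
  tour-adjacent i = step-adjacent (tour-step i)

  same-diagonal : ∀ {u v u' v'} → cyc u ≡ cyc u' → cyc v ≡ cyc v' → suc (u + v) ≈ suc (u' + v')
  same-diagonal {u} {v} {u'} {v'} eu ev =
    ≈-suc {u + v} {u' + v'} (≈-+ {u} {u'} {v} {v'} (cyc-≈⁻¹ eu) (cyc-≈⁻¹ ev))

  same-diagonal-swapped : ∀ {u v u' v'} → cyc u ≡ cyc v' → cyc v ≡ cyc u' → suc (u + v) ≈ suc (u' + v')
  same-diagonal-swapped {u} {v} {u'} {v'} eu ev =
    trans (same-diagonal eu ev) (cong (λ k → suc k % N) (+-comm v' u'))

  step-deterministic : ∀ {X Y X' Y'} → Step X Y → Step X' Y' → X ≡ X' → Y ≡ Y'
  step-deterministic (horizontal u v _) (horizontal u' v' _) eq =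
    cong₂ _,_ (cyc-suc-cong (,-injectiveˡ eq)) (,-injectiveʳ eq)
  step-deterministic (horizontal u v off) (vertical u' v' on) eq =
    ⊥-elim (off (trans (same-diagonal (,-injectiveˡ eq) (,-injectiveʳ eq)) on))
  step-deterministic (vertical u v on) (horizontal u' v' off) eq =
    ⊥-elim (off (trans (sym (same-diagonal (,-injectiveˡ eq) (,-injectiveʳ eq))) on))
  step-deterministic (vertical u v _) (vertical u' v' _) eq =
    cong₂ _,_ (,-injectiveˡ eq) (cyc-suc-cong (,-injectiveʳ eq))

  step-in-tour : ∀ {X Y} → Step X Y → CycleEdge tour X Y
  step-in-tour {X} s with tour-surjective X
  ... | j , refl = j , inj₁ (refl , step-deterministic s (tour-step j) refl)

  tour-edge-step : ∀ {X Y} → CycleEdge tour X Y → Step X Y ⊎ Step Y X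
  tour-edge-step (j , inj₁ (refl , refl)) = inj₁ (tour-step j)
  tour-edge-step (j , inj₂ (refl , refl)) = inj₂ (tour-step j)

  step-fixing-fst : ∀ {X Y} → Step X Y → proj₁ X ≡ proj₁ Y → CycleEdge cyc (proj₂ X) (proj₂ Y)
  step-fixing-fst (horizontal u v _) eq = ⊥-elim (cyc-suc-distinct u eq)
  step-fixing-fst (vertical u v _)   _  = v , inj₁ (refl , refl)

  step-fixing-snd : ∀ {X Y} → Step X Y → proj₂ X ≡ proj₂ Y → CycleEdge cyc (proj₁ X) (proj₁ Y)
  step-fixing-snd (horizontal u v _) _  = u , inj₁ (refl , refl)
  step-fixing-snd (vertical u v _)   eq = ⊥-elim (cyc-suc-distinct v eq)

  tour-edge-fixing-fst : ∀ {X Y} → CycleEdge tour X Y → proj₁ X ≡ proj₁ Y → CycleEdge cyc (proj₂ X) (proj₂ Y)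
  tour-edge-fixing-fst e eq with tour-edge-step e
  ... | inj₁ s = step-fixing-fst s eq
  ... | inj₂ s = CycleEdge-sym (step-fixing-fst s (sym eq))

  tour-edge-fixing-snd : ∀ {X Y} → CycleEdge tour X Y → proj₂ X ≡ proj₂ Y → CycleEdge cyc (proj₁ X) (proj₁ Y)
  tour-edge-fixing-snd e eq with tour-edge-step e
  ... | inj₁ s = step-fixing-snd s eq
  ... | inj₂ s = CycleEdge-sym (step-fixing-snd s (sym eq))

  -- The coordinate swap of a step is never a tour edge: it changes the
  -- direction of motion without changing the anti-diagonal, and reading it
  -- backwards would reverse a cycle edge of G, impossible as N ≥ 3.
  swapped-horizontal : ∀ {u v} → ¬ (suc (u + v) ≈ 0) →
                       ¬ CycleEdge tour (cyc v , cyc u) (cyc v , cyc (suc u))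
  swapped-horizontal {u} {v} off e = excluded (tour-edge-step e) refl refl
    where
    excluded : ∀ {X Y} → Step X Y ⊎ Step Y X → X ≡ (cyc v , cyc u) → Y ≡ (cyc v , cyc (suc u)) → ⊥
    excluded (inj₁ (horizontal u' v' _)) eX eY =
      cyc-suc-distinct u' (trans (,-injectiveˡ eX) (sym (,-injectiveˡ eY)))
    excluded (inj₂ (horizontal u' v' _)) eX eY =
      cyc-suc-distinct u' (trans (,-injectiveˡ eY) (sym (,-injectiveˡ eX)))
    excluded (inj₁ (vertical u' v' on)) eX eY =
      off (trans (same-diagonal-swapped (sym (,-injectiveʳ eX)) (sym (,-injectiveˡ eX))) on)
    excluded (inj₂ (vertical u' v' _)) eX eY =
      no-reversal u v' (sym (,-injectiveʳ eX)) (sym (,-injectiveʳ eY))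

  swapped-vertical : ∀ {u v} → suc (u + v) ≈ 0 →
                     ¬ CycleEdge tour (cyc v , cyc u) (cyc (suc v) , cyc u)
  swapped-vertical {u} {v} on e = excluded (tour-edge-step e) refl refl
    where
    excluded : ∀ {X Y} → Step X Y ⊎ Step Y X → X ≡ (cyc v , cyc u) → Y ≡ (cyc (suc v) , cyc u) → ⊥
    excluded (inj₁ (horizontal u' v' off)) eX eY =
      off (trans (same-diagonal-swapped (,-injectiveˡ eX) (,-injectiveʳ eX)) on)
    excluded (inj₂ (horizontal u' v' _)) eX eY =
      no-reversal v u' (sym (,-injectiveˡ eX)) (sym (,-injectiveˡ eY))
    excluded (inj₁ (vertical u' v' _)) eX eY =
      cyc-suc-distinct v' (trans (,-injectiveʳ eX) (sym (,-injectiveʳ eY)))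
    excluded (inj₂ (vertical u' v' _)) eX eY =
      cyc-suc-distinct v' (trans (,-injectiveʳ eY) (sym (,-injectiveʳ eX)))

  tour-covers : ∀ i m → CycleEdge tour (cyc i , cyc m) (cyc (suc i) , cyc m)
                      ⊎ CycleEdge tour (cyc m , cyc i) (cyc m , cyc (suc i))
  tour-covers i m with suc (i + m) % N ≟ 0 % N
  ... | no off = inj₁ (step-in-tour (horizontal i m off))
  ... | yes on = inj₂ (step-in-tour (vertical m i (trans (cong (λ k → suc k % N) (+-comm m i)) on)))

  Sym□ : Set
  Sym□ = Sym × Bool

  actBoth : Sym → V × V → V × V
  actBoth p (x , y) = act p x , act p y

  act□ : Sym□ → V × V → V × V
  act□ (p , s) X = swapIf s (actBoth p X)

  one□ : Sym□
  one□ = one , false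

  _·□_ : Sym□ → Sym□ → Sym□
  (p , s) ·□ (q , t) = p · q , s xor t

  _⁻¹□ : Sym□ → Sym□
  (p , s) ⁻¹□ = p ⁻¹ , s

  swapIf-actBoth : ∀ s p X → swapIf s (actBoth p X) ≡ actBoth p (swapIf s X)
  swapIf-actBoth false p X = refl
  swapIf-actBoth true  p X = refl

  act□-one : ∀ X → act□ one□ X ≡ X
  act□-one (x , y) = cong₂ _,_ (act-one x) (act-one y)

  act□-· : ∀ g h X → act□ (g ·□ h) X ≡ act□ g (act□ h X)
  act□-· (p , s) (q , t) X = begin
    swapIf (s xor t) (actBoth (p · q) X)               ≡⟨ cong (swapIf (s xor t)) (cong₂ _,_ (act-· p q _) (act-· p q _)) ⟩
    swapIf (s xor t) (actBoth p (actBoth q X))         ≡⟨ swapIf-xor s t (actBoth p (actBoth q X)) ⟩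
    swapIf s (swapIf t (actBoth p (actBoth q X)))      ≡⟨ cong (swapIf s) (swapIf-actBoth t p _) ⟩
    swapIf s (actBoth p (swapIf t (actBoth q X)))      ∎
    where open ≡-Reasoning

  act□-cancel : ∀ s p q → (∀ x → act p (act q x) ≡ x) → ∀ X → act□ (p , s) (act□ (q , s) X) ≡ X
  act□-cancel s p q pq X = begin
    swapIf s (actBoth p (swapIf s (actBoth q X)))   ≡⟨ cong (swapIf s) (swapIf-actBoth s p _) ⟨
    swapIf s (swapIf s (actBoth p (actBoth q X)))   ≡⟨ swapIf-involutive s (actBoth p (actBoth q X)) ⟩
    actBoth p (actBoth q X)                         ≡⟨ cong₂ _,_ (pq _) (pq _) ⟩
    X                                               ∎
    where open ≡-Reasoning

  act□-adjacent : ∀ g {X Y} → X ~□ Y → act□ g X ~□ act□ g Y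
  act□-adjacent (p , false) (inj₁ (x~x' , y≡y')) = inj₁ (act-adjacent p x~x' , cong (act p) y≡y')
  act□-adjacent (p , false) (inj₂ (x≡x' , y~y')) = inj₂ (cong (act p) x≡x' , act-adjacent p y~y')
  act□-adjacent (p , true)  (inj₁ (x~x' , y≡y')) = inj₂ (cong (act p) y≡y' , act-adjacent p x~x')
  act□-adjacent (p , true)  (inj₂ (x≡x' , y~y')) = inj₁ (act-adjacent p y~y' , cong (act p) x≡x')

  -- Rigidity.  An element fixing every vertex of G acts on G □ G as the flag
  -- alone; if it moves a step onto a tour edge, that flag cannot be a swap.
  actBoth-trivial : ∀ p → (∀ z → act p z ≡ z) → ∀ X → actBoth p X ≡ X
  actBoth-trivial p fix (x , y) = cong₂ _,_ (fix x) (fix y)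

  moves-cycle-edge-onto-cycle-edge : ∀ p u → CycleEdge cyc (act p (cyc u)) (act p (cyc (suc u))) →
                                     ∀ z → act p z ≡ z
  moves-cycle-edge-onto-cycle-edge p u = rigidity p (cyc u) (cyc (suc u)) (u , inj₁ (refl , refl))

  step-rigidity : ∀ p s {U W} → Step U W → CycleEdge tour (act□ (p , s) U) (act□ (p , s) W) →
                  ∀ Z → act□ (p , s) Z ≡ Z
  step-rigidity p false (horizontal u v _) e =
    actBoth-trivial p (moves-cycle-edge-onto-cycle-edge p u (tour-edge-fixing-snd e refl))
  step-rigidity p false (vertical u v _) e =
    actBoth-trivial p (moves-cycle-edge-onto-cycle-edge p v (tour-edge-fixing-fst e refl))
  step-rigidity p true (horizontal u v off) e = ⊥-elim (swapped-horizontal off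
    (subst₂ (CycleEdge tour) (cong swap (actBoth-trivial p fix _)) (cong swap (actBoth-trivial p fix _)) e))
    where
    fix = moves-cycle-edge-onto-cycle-edge p u (tour-edge-fixing-fst e refl)
  step-rigidity p true (vertical u v on) e = ⊥-elim (swapped-vertical on
    (subst₂ (CycleEdge tour) (cong swap (actBoth-trivial p fix _)) (cong swap (actBoth-trivial p fix _)) e))
    where
    fix = moves-cycle-edge-onto-cycle-edge p v (tour-edge-fixing-snd e refl)

  rigidity□ : ∀ g U W → CycleEdge tour U W → CycleEdge tour (act□ g U) (act□ g W) → ∀ Z → act□ g Z ≡ Z
  rigidity□ (p , s) U W e e' with tour-edge-step e
  ... | inj₁ step = step-rigidity p s step e'
  ... | inj₂ step = step-rigidity p s step (CycleEdge-sym e')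

  Translated : V × V → V × V → Set
  Translated X Y = ∃[ g ] ∃[ U ] ∃[ W ] (CycleEdge tour U W × X ≡ act□ g U × Y ≡ act□ g W)

  Translated-sym : ∀ {X Y} → Translated X Y → Translated Y X
  Translated-sym (g , U , W , e , X≡ , Y≡) = g , W , U , CycleEdge-sym e , Y≡ , X≡

  translated-cycle-edge : ∀ p s i m →
    Translated (swapIf s (act p (cyc i) , act p (cyc m))) (swapIf s (act p (cyc (suc i)) , act p (cyc m)))
  translated-cycle-edge p s i m with tour-covers i m
  ... | inj₁ e = (p , s) , _ , _ , e , refl , refl
  ... | inj₂ e = (p , not s) , _ , _ , e , swap-flag s , swap-flag s
    where
    swap-flag : ∀ s {a b : V} → swapIf s (a , b) ≡ swapIf (not s) (b , a)
    swap-flag false = refl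
    swap-flag true  = refl

  orbit-point : ∀ p y → ∃[ m ] (y ≡ act p (cyc m))
  orbit-point p y with cyc-surjective (act (p ⁻¹) y)
  ... | m , eq = m , sym (trans (cong (act p) eq) (act-inverseʳ p y))

  lift-translate : ∀ s {x x' y} → ∃[ p ] ∃[ u ] ∃[ v ] (CycleEdge cyc u v × x ≡ act p u × x' ≡ act p v) →
                   Translated (swapIf s (x , y)) (swapIf s (x' , y))
  lift-translate s {y = y} (p , _ , _ , (i , inj₁ (refl , refl)) , refl , refl) with orbit-point p y
  ... | m , refl = translated-cycle-edge p s i m
  lift-translate s {y = y} (p , _ , _ , (i , inj₂ (refl , refl)) , refl , refl) with orbit-point p y
  ... | m , refl = Translated-sym (translated-cycle-edge p s i m)

  covering□ : ∀ X Y → X ~□ Y → Translated X Y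
  covering□ (x , y) (x' , y') (inj₁ (x~x' , refl)) = lift-translate false (covering x x' x~x')
  covering□ (x , y) (x' , y') (inj₂ (refl , y~y')) = lift-translate true (covering y y' y~y')

  fundamental : FundamentalCycle (G □ G) M²
  fundamental = record
    { length≥3       = ≤-trans length≥3 (m≤m+n M _)
    ; cyc            = tour
    ; cyc-periodic   = tour-periodic
    ; cyc-injective  = tour-injective
    ; cyc-surjective = tour-surjective
    ; cyc-adjacent   = tour-adjacent
    ; Sym            = Sym□
    ; one            = one□
    ; _·_            = _·□_
    ; _⁻¹            = _⁻¹□
    ; act            = act□
    ; act-one        = act□-one
    ; act-·          = act□-·
    ; act-inverseˡ   = λ { (p , s) → act□-cancel s (p ⁻¹) p (act-inverseˡ p) }
    ; act-inverseʳ   = λ { (p , s) → act□-cancel s p (p ⁻¹) (act-inverseʳ p) }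
    ; act-adjacent   = act□-adjacent
    ; covering       = covering□
    ; rigidity       = rigidity□
    }

-- Two symmetries carrying cycle edges onto the same edge agree everywhere:
-- q⁻¹ · p carries one cycle edge onto another, so it acts trivially.
module Agreement {G : Graph} {M : ℕ} (F : FundamentalCycle G M) where
  open FundamentalCycle F

  same-action : ∀ p q {u v u' v'} → CycleEdge cyc u v → CycleEdge cyc u' v' →
                act p u ≡ act q u' → act p v ≡ act q v' → ∀ z → act p z ≡ act q z
  same-action p q {u} {v} {u'} {v'} e e' pu≡ pv≡ z = begin
    act p z                        ≡⟨ act-inverseʳ q (act p z) ⟨
    act q (act (q ⁻¹) (act p z))   ≡⟨ cong (act q) (act-· (q ⁻¹) p z) ⟨
    act q (act r z)                ≡⟨ cong (act q) (trivial z) ⟩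
    act q z                        ∎
    where
    open ≡-Reasoning
    r = (q ⁻¹) · p
    r-carries : ∀ {w w'} → act p w ≡ act q w' → act r w ≡ w'
    r-carries {w} {w'} eq = trans (act-· (q ⁻¹) p w) (trans (cong (act (q ⁻¹)) eq) (act-inverseˡ q w'))
    trivial : ∀ z → act r z ≡ z
    trivial = rigidity r u v e (subst₂ (CycleEdge cyc) (sym (r-carries pu≡)) (sym (r-carries pv≡)) e')

record Iso (G H : Graph) : Set where
  field
    to            : Graph.V G → Graph.V H
    from          : Graph.V H → Graph.V G
    from-to       : ∀ x → from (to x) ≡ x
    to-from       : ∀ y → to (from y) ≡ y
    to-adjacent   : ∀ {x x'} → Graph._~_ G x x' → Graph._~_ H (to x) (to x')
    from-adjacent : ∀ {y y'} → Graph._~_ H y y' → Graph._~_ G (from y) (from y')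

CycleEdge-map : ∀ {A B : Set} {c : ℕ → A} {d : ℕ → B} (f : A → B) → (∀ i → f (c i) ≡ d i) →
                ∀ {u v} → CycleEdge c u v → CycleEdge d (f u) (f v)
CycleEdge-map f fc≡d (i , inj₁ (refl , refl)) = i , inj₁ (fc≡d i , fc≡d (suc i))
CycleEdge-map f fc≡d (i , inj₂ (refl , refl)) = i , inj₂ (fc≡d (suc i) , fc≡d i)

transfer : ∀ {G H M} → Iso G H → FundamentalCycle G M → FundamentalCycle H M
transfer {G} {H} {M} I F = record
  { length≥3       = length≥3
  ; cyc            = λ i → to (cyc i)
  ; cyc-periodic   = λ i → cong to (cyc-periodic i)
  ; cyc-injective  = λ i j i< j< eq → cyc-injective i j i< j< (to-injective eq)
  ; cyc-surjective = λ y → proj₁ (cyc-surjective (from y)) ,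
                           trans (cong to (proj₂ (cyc-surjective (from y)))) (to-from y)
  ; cyc-adjacent   = λ i → to-adjacent (cyc-adjacent i)
  ; Sym            = Sym
  ; one            = one
  ; _·_            = _·_
  ; _⁻¹            = _⁻¹
  ; act            = conj
  ; act-one        = λ y → trans (cong to (act-one (from y))) (to-from y)
  ; act-·          = λ p q y → cong to (trans (act-· p q (from y)) (cong (act p) (sym (from-to _))))
  ; act-inverseˡ   = λ p y → trans (cong (λ x → to (act (p ⁻¹) x)) (from-to _))
                               (trans (cong to (act-inverseˡ p (from y))) (to-from y))
  ; act-inverseʳ   = λ p y → trans (cong (λ x → to (act p x)) (from-to _))
                               (trans (cong to (act-inverseʳ p (from y))) (to-from y))
  ; act-adjacent   = λ p y~y' → to-adjacent (act-adjacent p (from-adjacent y~y'))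
  ; covering       = covering'
  ; rigidity       = rigidity'
  }
  where
  open Iso I
  open FundamentalCycle F
  open Graph H using (_~_)

  conj : Sym → Graph.V H → Graph.V H
  conj p y = to (act p (from y))

  to-injective : ∀ {x x'} → to x ≡ to x' → x ≡ x'
  to-injective {x} {x'} eq = trans (sym (from-to x)) (trans (cong from eq) (from-to x'))

  covering' : ∀ y y' → y ~ y' → ∃[ p ] ∃[ u ] ∃[ v ]
                (CycleEdge (λ i → to (cyc i)) u v × y ≡ conj p u × y' ≡ conj p v)
  covering' y y' y~y' with covering (from y) (from y') (from-adjacent y~y')
  ... | p , u , v , e , y≡ , y'≡ = p , to u , to v , CycleEdge-map to (λ _ → refl) e ,
        trans (sym (to-from y))  (cong to (trans y≡  (cong (act p) (sym (from-to u))))) ,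
        trans (sym (to-from y')) (cong to (trans y'≡ (cong (act p) (sym (from-to v)))))

  rigidity' : ∀ p u v → CycleEdge (λ i → to (cyc i)) u v →
              CycleEdge (λ i → to (cyc i)) (conj p u) (conj p v) → ∀ y → conj p y ≡ y
  rigidity' p u v e e' y = trans (cong to (rigidity p (from u) (from v) (back e)
                                   (subst₂ (CycleEdge cyc) (from-to _) (from-to _) (back e')) (from y)))
                                 (to-from y)
    where
    back : ∀ {w w'} → CycleEdge (λ i → to (cyc i)) w w' → CycleEdge cyc (from w) (from w')
    back = CycleEdge-map from (λ i → from-to (cyc i))

∣Δ∣-comm : ∀ {n} (x y : Vertex n) → ∣ x Δ y ∣ ≡ ∣ y Δ x ∣
∣Δ∣-comm x y = cong ∣_∣ (∪-comm (x ─ y) (y ─ x))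

∣Δ∣-self : ∀ {n} (x : Vertex n) → ∣ x Δ x ∣ ≡ 0
∣Δ∣-self []          = refl
∣Δ∣-self (true  ∷ x) = ∣Δ∣-self x
∣Δ∣-self (false ∷ x) = ∣Δ∣-self x

∣Δ∣≡0⇒≡ : ∀ {n} (x y : Vertex n) → ∣ x Δ y ∣ ≡ 0 → x ≡ y
∣Δ∣≡0⇒≡ []          []          _  = refl
∣Δ∣≡0⇒≡ (true  ∷ x) (true  ∷ y) eq = cong (true ∷_) (∣Δ∣≡0⇒≡ x y eq)
∣Δ∣≡0⇒≡ (false ∷ x) (false ∷ y) eq = cong (false ∷_) (∣Δ∣≡0⇒≡ x y eq)
∣Δ∣≡0⇒≡ (true  ∷ x) (false ∷ y) ()
∣Δ∣≡0⇒≡ (false ∷ x) (true  ∷ y) ()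

∣Δ∣-++ : ∀ {m n} (a c : Vertex m) (b d : Vertex n) → ∣ (a ++ b) Δ (c ++ d) ∣ ≡ ∣ a Δ c ∣ + ∣ b Δ d ∣
∣Δ∣-++ []          []          b d = refl
∣Δ∣-++ (true  ∷ a) (true  ∷ c) b d = ∣Δ∣-++ a c b d
∣Δ∣-++ (true  ∷ a) (false ∷ c) b d = cong suc (∣Δ∣-++ a c b d)
∣Δ∣-++ (false ∷ a) (true  ∷ c) b d = cong suc (∣Δ∣-++ a c b d)
∣Δ∣-++ (false ∷ a) (false ∷ c) b d = ∣Δ∣-++ a c b d

Q : ℕ → Graph
Q n = record
  { V        = Vertex n
  ; _~_      = Adj
  ; ~-sym    = λ {x} {y} x~y → trans (∣Δ∣-comm y x) x~y
  ; ~-irrefl = λ {x} x~x → 0≢1+n (trans (sym (∣Δ∣-self x)) x~x)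
  }

sum≡1 : ∀ a b → a + b ≡ 1 → (a ≡ 1 × b ≡ 0) ⊎ (a ≡ 0 × b ≡ 1)
sum≡1 zero          b     eq = inj₂ (refl , eq)
sum≡1 (suc zero)    zero  _  = inj₁ (refl , refl)
sum≡1 (suc zero)    (suc b) ()
sum≡1 (suc (suc a)) b     ()

cube-product : ∀ m n → Iso (Q m □ Q n) (Q (m + n))
cube-product m n = record
  { to            = λ (a , b) → a ++ b
  ; from          = split
  ; from-to       = split-++
  ; to-from       = take++drop≡id m
  ; to-adjacent   = concat-adjacent
  ; from-adjacent = λ {X} {Y} X~Y → split-adjacent (split X) (split Y)
                      (subst₂ Adj (sym (take++drop≡id m X)) (sym (take++drop≡id m Y)) X~Y)
  }
  where
  split : Vertex (m + n) → Vertex m × Vertex n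
  split X = take m X , drop m X

  split-++ : ∀ (ab : Vertex m × Vertex n) → split (proj₁ ab ++ proj₂ ab) ≡ ab
  split-++ (a , b) = cong₂ _,_ (++-injectiveˡ _ a eq) (++-injectiveʳ _ a eq)
    where
    eq = take++drop≡id m (a ++ b)

  concat-adjacent : ∀ {X Y} → Graph._~_ (Q m □ Q n) X Y → Adj (proj₁ X ++ proj₂ X) (proj₁ Y ++ proj₂ Y)
  concat-adjacent {a , b} {c , .b} (inj₁ (a~c , refl)) =
    trans (∣Δ∣-++ a c b b) (cong₂ _+_ a~c (∣Δ∣-self b))
  concat-adjacent {a , b} {.a , d} (inj₂ (refl , b~d)) =
    trans (∣Δ∣-++ a a b d) (cong₂ _+_ (∣Δ∣-self a) b~d)

  split-adjacent : ∀ X Y → Adj (proj₁ X ++ proj₂ X) (proj₁ Y ++ proj₂ Y) → Graph._~_ (Q m □ Q n) X Y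
  split-adjacent (a , b) (c , d) adj with sum≡1 ∣ a Δ c ∣ ∣ b Δ d ∣ (trans (sym (∣Δ∣-++ a c b d)) adj)
  ... | inj₁ (a~c , bd≡0) = inj₁ (a~c , ∣Δ∣≡0⇒≡ b d bd≡0)
  ... | inj₂ (ac≡0 , b~d) = inj₂ (∣Δ∣≡0⇒≡ a c ac≡0 , b~d)

square-cycle : ℕ → Vertex 2
square-cycle 0 = false ∷ false ∷ []
square-cycle 1 = true  ∷ false ∷ []
square-cycle 2 = true  ∷ true  ∷ []
square-cycle 3 = false ∷ true  ∷ []
square-cycle (suc (suc (suc (suc i)))) = square-cycle i

square-position : Vertex 2 → ℕ
square-position (false ∷ false ∷ []) = 0
square-position (true  ∷ false ∷ []) = 1
square-position (true  ∷ true  ∷ []) = 2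
square-position (false ∷ true  ∷ []) = 3

square-position-cycle : ∀ i → i < 4 → square-position (square-cycle i) ≡ i
square-position-cycle 0 _ = refl
square-position-cycle 1 _ = refl
square-position-cycle 2 _ = refl
square-position-cycle 3 _ = refl
square-position-cycle (suc (suc (suc (suc i)))) (s≤s (s≤s (s≤s (s≤s ()))))

square-cycle-position : ∀ x → square-cycle (square-position x) ≡ x
square-cycle-position (false ∷ false ∷ []) = refl
square-cycle-position (true  ∷ false ∷ []) = refl
square-cycle-position (true  ∷ true  ∷ []) = refl
square-cycle-position (false ∷ true  ∷ []) = refl

square-cycle-adjacent : ∀ i → Adj (square-cycle i) (square-cycle (suc i))
square-cycle-adjacent 0 = refl
square-cycle-adjacent 1 = refl
square-cycle-adjacent 2 = refl
square-cycle-adjacent 3 = refl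
square-cycle-adjacent (suc (suc (suc (suc i)))) = square-cycle-adjacent i

square-edge : ∀ x y → Adj x y → CycleEdge square-cycle x y
square-edge (false ∷ false ∷ []) (true  ∷ false ∷ []) _ = 0 , inj₁ (refl , refl)
square-edge (true  ∷ false ∷ []) (false ∷ false ∷ []) _ = 0 , inj₂ (refl , refl)
square-edge (true  ∷ false ∷ []) (true  ∷ true  ∷ []) _ = 1 , inj₁ (refl , refl)
square-edge (true  ∷ true  ∷ []) (true  ∷ false ∷ []) _ = 1 , inj₂ (refl , refl)
square-edge (true  ∷ true  ∷ []) (false ∷ true  ∷ []) _ = 2 , inj₁ (refl , refl)
square-edge (false ∷ true  ∷ []) (true  ∷ true  ∷ []) _ = 2 , inj₂ (refl , refl)
square-edge (false ∷ true  ∷ []) (false ∷ false ∷ []) _ = 3 , inj₁ (refl , refl)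
square-edge (false ∷ false ∷ []) (false ∷ true  ∷ []) _ = 3 , inj₂ (refl , refl)
square-edge (false ∷ false ∷ []) (false ∷ false ∷ []) ()
square-edge (false ∷ false ∷ []) (true  ∷ true  ∷ []) ()
square-edge (true  ∷ false ∷ []) (true  ∷ false ∷ []) ()
square-edge (true  ∷ false ∷ []) (false ∷ true  ∷ []) ()
square-edge (true  ∷ true  ∷ []) (true  ∷ true  ∷ []) ()
square-edge (true  ∷ true  ∷ []) (false ∷ false ∷ []) ()
square-edge (false ∷ true  ∷ []) (false ∷ true  ∷ []) ()
square-edge (false ∷ true  ∷ []) (true  ∷ false ∷ []) ()

Q₂-fundamental : FundamentalCycle (Q 2) 3
Q₂-fundamental = record
  { length≥3       = s≤s (s≤s z≤n)
  ; cyc            = square-cycle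
  ; cyc-periodic   = λ i → cong square-cycle (+-comm i 4)
  ; cyc-injective  = λ i j i<4 j<4 eq → trans (sym (square-position-cycle i i<4))
                       (trans (cong square-position eq) (square-position-cycle j j<4))
  ; cyc-surjective = λ x → square-position x , square-cycle-position x
  ; cyc-adjacent   = square-cycle-adjacent
  ; Sym            = ⊤
  ; one            = tt
  ; _·_            = λ _ _ → tt
  ; _⁻¹            = λ _ → tt
  ; act            = λ _ x → x
  ; act-one        = λ _ → refl
  ; act-·          = λ _ _ _ → refl
  ; act-inverseˡ   = λ _ _ → refl
  ; act-inverseʳ   = λ _ _ → refl
  ; act-adjacent   = λ _ x~y → x~y
  ; covering       = λ x y x~y → tt , x , y , square-edge x y x~y , refl , refl
  ; rigidity       = λ _ _ _ _ _ _ → refl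
  }

pred2^-suc : ∀ n → suc (pred2^ n) ≡ 2 ^ n
pred2^-suc n = m+[n∸m]≡n (m^n>0 2 n)

pred2^-double : ∀ n → pred2^ n + pred2^ n * suc (pred2^ n) ≡ pred2^ (n + n)
pred2^-double n = suc-injective (begin
  suc (pred2^ n) * suc (pred2^ n)   ≡⟨ cong₂ _*_ (pred2^-suc n) (pred2^-suc n) ⟩
  2 ^ n * 2 ^ n                     ≡⟨ ^-distribˡ-+-* 2 n n ⟨
  2 ^ (n + n)                       ≡⟨ pred2^-suc (n + n) ⟨
  suc (pred2^ (n + n))              ∎)
  where open ≡-Reasoning

doubling : ∀ n → FundamentalCycle (Q n) (pred2^ n) → FundamentalCycle (Q (n + n)) (pred2^ (n + n))
doubling n F = subst (FundamentalCycle (Q (n + n))) (pred2^-double n)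
                 (transfer (cube-product n n) (Square.fundamental F))

hypercube-fundamental : ∀ k → FundamentalCycle (Q (2 ^ suc k)) (pred2^ (2 ^ suc k))
hypercube-fundamental zero    = Q₂-fundamental
hypercube-fundamental (suc k) = subst (λ m → FundamentalCycle (Q m) (pred2^ m))
                                  (cong (n +_) (sym (+-identityʳ n))) (doubling n (hypercube-fundamental k))
  where
  n = 2 ^ suc k

translate-ext : ∀ {n} {g h : Aut n} {E : EdgeSet n} → (∀ z → fun g z ≡ fun h z) →
                ∀ {x y} → Translate g E x y → Translate h E x y
translate-ext agree (u , v , e , x≡ , y≡) = u , v , e , trans x≡ (agree u) , trans y≡ (agree v)

module Conclusion (n : ℕ) (F : FundamentalCycle (Q n) (pred2^ n)) where
  open FundamentalCycle F
  open Mod (pred2^ n)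
  open CycleFacts F
  open Agreement F

  vertex : Fin N → Vertex n
  vertex i = cyc (toℕ i)

  vertex-mod : ∀ a → vertex (a mod N) ≡ cyc a
  vertex-mod a = trans (cong cyc (toℕ-fromℕ< (m%n<n a N))) (cyc-mod a)

  vertex-next-mod : ∀ a → vertex (nextMod (a mod N)) ≡ cyc (suc a)
  vertex-next-mod a = trans (vertex-mod (suc (toℕ (a mod N)))) (cyc-suc-cong (vertex-mod a))

  hamCycle : HamCycle n
  hamCycle = record
    { vert       = vertex
    ; injective  = λ {i} {j} eq → toℕ-injective (cyc-injective _ _ (toℕ<n i) (toℕ<n j) eq)
    ; surjective = λ x → proj₁ (cyc-surjective x) mod N ,
                         λ { refl → trans (vertex-mod _) (proj₂ (cyc-surjective x)) }
    ; adjacent   = λ i → subst (Adj (vertex i)) (sym (vertex-mod (suc (toℕ i)))) (cyc-adjacent (toℕ i))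
    }

  edges : EdgeSet n
  edges = CycleEdges hamCycle

  edges→cycle : ∀ {x y} → edges x y → CycleEdge cyc x y
  edges→cycle (i , inj₁ (x≡ , y≡)) = toℕ i , inj₁ (x≡ , trans y≡ (vertex-mod (suc (toℕ i))))
  edges→cycle (i , inj₂ (y≡ , x≡)) = toℕ i , inj₂ (trans x≡ (vertex-mod (suc (toℕ i))) , y≡)

  cycle→edges : ∀ {x y} → CycleEdge cyc x y → edges x y
  cycle→edges (i , inj₁ (x≡ , y≡)) = i mod N , inj₁ (trans x≡ (sym (vertex-mod i)) , trans y≡ (sym (vertex-next-mod i)))
  cycle→edges (i , inj₂ (x≡ , y≡)) = i mod N , inj₂ (trans y≡ (sym (vertex-mod i)) , trans x≡ (sym (vertex-next-mod i)))

  edges-adjacent : IsEdgeSubset edges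
  edges-adjacent x y e with edges→cycle e
  ... | i , inj₁ (refl , refl) = cyc-adjacent i
  ... | i , inj₂ (refl , refl) = Graph.~-sym (Q n) {cyc i} {cyc (suc i)} (cyc-adjacent i)

  induced : Sym → Aut n
  induced p = record
    { fun      = act p
    ; inv      = act (p ⁻¹)
    ; inv-fun  = act-inverseˡ p
    ; fun-inv  = act-inverseʳ p
    ; preserve = λ _ _ → act-adjacent p
    ; reflect  = λ x y x~y → subst₂ Adj (act-inverseˡ p x) (act-inverseˡ p y) (act-adjacent (p ⁻¹) x~y)
    }

  Induced : Aut n → Set
  Induced g = ∃[ p ] (∀ x → fun g x ≡ act p x)

  induced-subgroup : IsSubgroup Induced
  induced-subgroup = record
    { has-id  = one , λ x → sym (act-one x)
    ; has-∘   = λ { {g} {h} (p , g≗p) (q , h≗q) → p · q , λ x →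
                  trans (g≗p (fun h x)) (trans (cong (act p) (h≗q x)) (sym (act-· p q x))) }
    ; has-inv = λ { {g} (p , g≗p) → p ⁻¹ , λ x →
                  trans (sym (act-inverseˡ p (inv g x)))
                        (cong (act (p ⁻¹)) (trans (sym (g≗p (inv g x))) (fun-inv g x))) }
    }

  every-edge-translated : ∀ x y → Adj x y → ∃[ g ] (Induced g × Translate g edges x y)
  every-edge-translated x y x~y with covering x y x~y
  ... | p , u , v , e , x≡ , y≡ = induced p , (p , λ _ → refl) , u , v , cycle→edges e , x≡ , y≡

  -- Translates sharing an edge come from symmetries agreeing everywhere.
  translates-coincide : ∀ g h → Induced g → Induced h → ∀ x y →
    Translate g edges x y → Translate h edges x y →
    ∀ w z → (Translate g edges w z → Translate h edges w z) × (Translate h edges w z → Translate g edges w z)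
  translates-coincide g h (p , g≗p) (q , h≗q) x y (u , v , e , x≡ , y≡) (u' , v' , e' , x≡' , y≡') w z =
    translate-ext {g = g} {h} {edges} agree , translate-ext {g = h} {g} {edges} (λ a → sym (agree a))
    where
    carried : ∀ {s t} → fun g s ≡ fun h t → act p s ≡ act q t
    carried {s} {t} eq = trans (sym (g≗p s)) (trans eq (h≗q t))
    agree : ∀ a → fun g a ≡ fun h a
    agree a = trans (g≗p a) (trans (same-action p q (edges→cycle e) (edges→cycle e')
                (carried (trans (sym x≡) x≡')) (carried (trans (sym y≡) y≡')) a) (sym (h≗q a)))

  fundamental-edges : IsFundamental edges
  fundamental-edges = edges-adjacent , Induced , induced-subgroup , every-edge-translated , translates-coincide

theorem3 : (k : ℕ) → ∃[ C ] IsFundamental {2 ^ suc k} (CycleEdges C)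
theorem3 k = hamCycle , fundamental-edges
  where
  open Conclusion (2 ^ suc k) (hypercube-fundamental k)
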